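{- Let $m\le n$ and let $s^n_m$ be an $m$-selector of order $n$ with inputs $\langle x_1,\dots,x_n\rangle$ and outputs $\langle y_1,\dots,y_m\rangle$. For any partial assignment $\sigma$ consistent with $s^n_m$: (1) if $k$ input variables ($1\le k\le n$) are set to $1$ in $\sigma$, then unit propagation sets all of $y_1,\dots,y_{\min(k,m)}$ to $1$; (2) if $y_k=0$ (for some $1\le k\le m$) and exactly $k-1$ input variables are set to $1$ in $\sigma$, then unit propagation sets all the remaining input variables to $0$.
   Context: For $m\le n$, an $m$-selector of order $n$ with inputs $\bar{x}=\langle x_1,\dots,x_n\rangle$ and outputs $\bar{y}=\langle y_1,\dots,y_m\rangle$ is the CNF $s^n_m(\bar{x},\bar{y})=\{x_{i_1}\wedge\dots\wedge x_{i_p}\Rightarrow y_p : 1\le p\le m,\ 1\le i_1<\dots<i_p\le n\}$, where $a_1\wedge\dots\wedge a_p\Rightarrow b$ denotes the clause $\neg a_1\vee\dots\vee\neg a_p\vee b$. A partial assignment maps some variables to $\{0,1\}$ (others undefined); it is consistent with a CNF if every clause evaluates to true or undefined. Unit propagation repeatedly, until a fixpoint, takes a clause $(l\vee l_1\vee\dots\vee l_r)$ in which $l$ is undefined and either $r=0$ or $l_1,\dots,l_r$ are all false, and sets $l$ to true. -}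

module Defs where

open import Data.Nat using (ℕ; zero; suc; _≤_; _<_)
open import Data.Fin using (Fin; toℕ)
open import Data.Fin.Subset using (Subset; ∣_∣)
open import Data.Bool using (Bool; true; false)
open import Data.Maybe using (Maybe; just; nothing)
open import Data.List using (List; []; _∷_; map; _++_; length)
open import Data.List.Relation.Unary.All using (All)
open import Data.List.Relation.Unary.Any using (Any)
open import Data.List.Membership.Propositional using (_∈_)
open import Data.List.Relation.Unary.Linked using (Linked)
open import Data.Vec using (tabulate)
open import Data.Product using (Σ; ∃; _×_; _,_)
open import Data.Sum using (_⊎_)
open import Relation.Binary.PropositionalEquality using (_≡_; _≢_)
open import Relation.Binary.Construct.Closure.ReflexiveTransitive using (Star)
open import Relation.Nullary using (¬_)
import Data.Fin as F

-- Variables of a selector of order n with m outputs: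
-- inputs x i (i : Fin n, i.e. x_{i+1}) and outputs y j (j : Fin m, i.e. y_{j+1}).
data Var (n m : ℕ) : Set where
  x : Fin n → Var n m
  y : Fin m → Var n m

data Lit (V : Set) : Set where
  pos : V → Lit V
  neg : V → Lit V

Clause : Set → Set
Clause V = List (Lit V)

CNF : Set → Set₁
CNF V = Clause V → Set

PAssign : Set → Set
PAssign V = V → Maybe Bool

not : Bool → Bool
not true = false
not false = true

litVal : {V : Set} → PAssign V → Lit V → Maybe Bool
litVal σ (pos v) = σ v
litVal σ (neg v) with σ v
... | just b = just (not b)
... | nothing = nothing

ClauseFalse : {V : Set} → PAssign V → Clause V → Set
ClauseFalse σ C = All (λ l → litVal σ l ≡ just false) C

Consistent : {V : Set} → CNF V → PAssign V → Set
Consistent F σ = ∀ C → F C → ¬ ClauseFalse σ C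

setLit : {V : Set} → ((a b : V) → Relation.Nullary.Dec (a ≡ b)) →
         PAssign V → Lit V → PAssign V
setLit _≟_ σ (pos v) w with w ≟ v
... | Relation.Nullary.yes _ = just true
... | Relation.Nullary.no _ = σ w
setLit _≟_ σ (neg v) w with w ≟ v
... | Relation.Nullary.yes _ = just false
... | Relation.Nullary.no _ = σ w

var-≟ : {n m : ℕ} → (a b : Var n m) → Relation.Nullary.Dec (a ≡ b)
var-≟ (x i) (x j) with i F.≟ j
... | Relation.Nullary.yes Relation.Binary.PropositionalEquality.refl = Relation.Nullary.yes Relation.Binary.PropositionalEquality.refl
... | Relation.Nullary.no ne = Relation.Nullary.no λ { Relation.Binary.PropositionalEquality.refl → ne Relation.Binary.PropositionalEquality.refl }
var-≟ (x i) (y j) = Relation.Nullary.no λ ()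
var-≟ (y i) (x j) = Relation.Nullary.no λ ()
var-≟ (y i) (y j) with i F.≟ j
... | Relation.Nullary.yes Relation.Binary.PropositionalEquality.refl = Relation.Nullary.yes Relation.Binary.PropositionalEquality.refl
... | Relation.Nullary.no ne = Relation.Nullary.no λ { Relation.Binary.PropositionalEquality.refl → ne Relation.Binary.PropositionalEquality.refl }

UPStep : {V : Set} → ((a b : V) → Relation.Nullary.Dec (a ≡ b)) →
         CNF V → PAssign V → PAssign V → Set
UPStep {V} eq F σ σ' =
  Σ (Clause V) λ C → Σ (Lit V) λ l →
    F C × l ∈ C × litVal σ l ≡ nothing ×
    All (λ l' → l' ≡ l ⊎ litVal σ l' ≡ just false) C ×
    σ' ≡ setLit eq σ l

UPFixpoint : {V : Set} → ((a b : V) → Relation.Nullary.Dec (a ≡ b)) →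
             CNF V → PAssign V → Set
UPFixpoint eq F σ = ∀ σ' → ¬ UPStep eq F σ σ'

UPResult : {V : Set} → ((a b : V) → Relation.Nullary.Dec (a ≡ b)) →
           CNF V → PAssign V → PAssign V → Set
UPResult eq F σ τ = Star (UPStep eq F) σ τ × UPFixpoint eq F τ

-- The clause x_{i_1} ∧ … ∧ x_{i_p} ⇒ y_p, i.e. ¬x_{i_1} ∨ … ∨ ¬x_{i_p} ∨ y_p.
selClause : {n m : ℕ} → List (Fin n) → Fin m → Clause (Var n m)
selClause is j = map (λ i → neg (x i)) is ++ (pos (y j) ∷ [])

-- The m-selector of order n: for 1 ≤ p ≤ m (p = toℕ j + 1, j : Fin m) and
-- 1 ≤ i_1 < … < i_p ≤ n (a strictly increasing list of length p).
selector : (n m : ℕ) → CNF (Var n m)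
selector n m C =
  Σ (Fin m) λ j → Σ (List (Fin n)) λ is →
    Linked F._<_ is × length is ≡ suc (toℕ j) × C ≡ selClause is j

isTrue : Maybe Bool → Bool
isTrue (just true) = true
isTrue _ = false

numTrueInputs : {n m : ℕ} → PAssign (Var n m) → ℕ
numTrueInputs {n} σ = ∣ tabulate {n = n} (λ i → isTrue (σ (x i))) ∣

-- Unit propagation only extends an assignment, and it can only falsify a literal whose
-- complement occurs in the formula. Hence if a clause is unit under a consistent σ (all its
-- literals but l are false) and the complement of l occurs nowhere, l is true at every fixpoint
-- reached from σ: had propagation falsified l, σ would falsify the whole clause, and had it left
-- l undefined, the clause would still fire. In a selector the inputs occur only negatively and
-- the outputs only positively, so it remains to find unit clauses:
-- (1) for p ≤ k, p of the true inputs x_{i_1}, …, x_{i_p} give x_{i_1} ∧ … ∧ x_{i_p} ⇒ y_p, unit on y_p;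
-- (2) if y_p = 0 and exactly p − 1 inputs are true, adding any other input x_i to them gives a
-- clause with p premises, unit on ¬x_i.
module Submission where

open import Defs
open import Data.Nat using (ℕ; suc; _≤_; _<_; z<s; s<s)
open import Data.Nat.Properties using (m≤n⇒m⊓n≡m)
open import Data.Fin as Fin using (Fin; toℕ)
open import Data.Fin.Subset using (Subset; ∣_∣; _∪_; ⁅_⁆; inside; outside)
  renaming (_∈_ to _∈ₛ_; _∉_ to _∉ₛ_)
open import Data.Fin.Subset.Properties using (∪-identityʳ; x∈p∪q⁺; x∈p∪q⁻; x∈⁅x⁆; x∈⁅y⁆⇒x≡y)
open import Data.Bool using (Bool; true; false)
open import Data.Maybe using (Maybe; just; nothing)
open import Data.Product using (∃; _×_; _,_)
open import Data.Sum using (_⊎_; inj₁; inj₂)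
import Data.Sum as Sum
open import Data.Empty using (⊥-elim)
open import Data.List using (List; []; _∷_; map; length; take)
open import Data.List.Properties using (length-map; length-take)
open import Data.List.Relation.Unary.All using (All; []; _∷_)
import Data.List.Relation.Unary.All as All
import Data.List.Relation.Unary.All.Properties as All
open import Data.List.Relation.Unary.AllPairs using (AllPairs; []; _∷_)
import Data.List.Relation.Unary.AllPairs as AllPairs
import Data.List.Relation.Unary.AllPairs.Properties as AllPairs
open import Data.List.Relation.Unary.Linked.Properties using (AllPairs⇒Linked)
open import Data.List.Relation.Unary.Any using (here; there)
open import Data.List.Membership.Propositional using (_∈_)
open import Data.List.Membership.Propositional.Properties using (∈-map⁺; ∈-++⁺ˡ; ∈-++⁺ʳ)
open import Data.Vec using ([]; _∷_; here; there; tabulate)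
open import Data.Vec.Properties using ([]=⇒lookup; lookup∘tabulate)
open import Relation.Binary.Definitions using (DecidableEquality)
open import Relation.Binary.Construct.Closure.ReflexiveTransitive using (Star; ε; _◅_)
open import Relation.Nullary using (¬_; yes; no)
open import Relation.Binary.PropositionalEquality using (_≡_; _≢_; refl; sym; trans; cong; subst)
open import Function using (_∘_)

private
  variable
    V : Set
    n m : ℕ
    b : Bool
    v : V
    σ τ : PAssign V

litVar : Lit V → V
litVar (pos v) = v
litVar (neg v) = v

complement : Lit V → Lit V
complement (pos v) = neg v
complement (neg v) = pos v

Occurs : CNF V → Lit V → Set
Occurs F l = ∃ λ C → F C × l ∈ C

_⊑_ : PAssign V → PAssign V → Set
σ ⊑ τ = ∀ {v b} → σ v ≡ just b → τ v ≡ just b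

litVal-undefined : (l : Lit V) → litVal σ l ≡ nothing → σ (litVar l) ≡ nothing
litVal-undefined (pos v) undef = undef
litVal-undefined {σ = σ} (neg v) undef with σ v
litVal-undefined (neg v) () | just _
... | nothing = refl

litVal-neg : (σ : PAssign V) → σ v ≡ just b → litVal σ (neg v) ≡ just (not b)
litVal-neg _ σv rewrite σv = refl

litVal-neg⁻ : (σ : PAssign V) → litVal σ (neg v) ≡ just true → σ v ≡ just false
litVal-neg⁻ {v = v} σ e with σ v
litVal-neg⁻ σ refl | just false = refl

litVal-mono : σ ⊑ τ → (l : Lit V) → litVal σ l ≡ just b → litVal τ l ≡ just b
litVal-mono ext (pos v) e = ext e
litVal-mono {σ = σ} ext (neg v) e with σ v in σv
litVal-mono ext (neg v) e | just c rewrite ext σv = e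
litVal-mono ext (neg v) () | nothing

module Propagation {V : Set} (_≟_ : DecidableEquality V) (F : CNF V) where

  setLit-extends : (l : Lit V) → litVal σ l ≡ nothing → σ ⊑ setLit _≟_ σ l
  setLit-extends {σ = σ} (pos u) undef {v} σv with v ≟ u
  ... | yes refl with () ← trans (sym σv) (litVal-undefined {σ = σ} (pos u) undef)
  ... | no _ = σv
  setLit-extends {σ = σ} (neg u) undef {v} σv with v ≟ u
  ... | yes refl with () ← trans (sym σv) (litVal-undefined {σ = σ} (neg u) undef)
  ... | no _ = σv

  setLit-falsifies : (l₀ l : Lit V) → litVal (setLit _≟_ σ l₀) l ≡ just false →
    litVal σ l ≡ just false ⊎ complement l ≡ l₀
  setLit-falsifies (pos u) (pos v) e with v ≟ u
  setLit-falsifies (pos u) (pos v) () | yes refl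
  ... | no _ = inj₁ e
  setLit-falsifies (pos u) (neg v) e with v ≟ u
  ... | yes refl = inj₂ refl
  setLit-falsifies {σ = σ} (pos u) (neg v) e | no _ with σ v
  ... | just _ = inj₁ e
  setLit-falsifies (pos u) (neg v) () | no _ | nothing
  setLit-falsifies (neg u) (pos v) e with v ≟ u
  ... | yes refl = inj₂ refl
  ... | no _ = inj₁ e
  setLit-falsifies (neg u) (neg v) e with v ≟ u
  setLit-falsifies (neg u) (neg v) () | yes refl
  setLit-falsifies {σ = σ} (neg u) (neg v) e | no _ with σ v
  ... | just _ = inj₁ e
  setLit-falsifies (neg u) (neg v) () | no _ | nothing

  Step : PAssign V → PAssign V → Set
  Step = UPStep _≟_ F

  step-extends : {σ′ : PAssign V} → Step σ σ′ → σ ⊑ σ′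
  step-extends (_ , l , _ , _ , undef , _ , refl) = setLit-extends l undef

  step-falsifies : {σ′ : PAssign V} (l : Lit V) → Step σ σ′ → litVal σ′ l ≡ just false →
    litVal σ l ≡ just false ⊎ Occurs F (complement l)
  step-falsifies l (C , l₀ , C∈F , l₀∈C , _ , _ , refl) e with setLit-falsifies l₀ l e
  ... | inj₁ σl = inj₁ σl
  ... | inj₂ refl = inj₂ (C , C∈F , l₀∈C)

  propagation-extends : Star Step σ τ → σ ⊑ τ
  propagation-extends ε e = e
  propagation-extends (s ◅ run) e = propagation-extends run (step-extends s e)

  propagation-falsifies : (l : Lit V) → Star Step σ τ → litVal τ l ≡ just false →
    litVal σ l ≡ just false ⊎ Occurs F (complement l)
  propagation-falsifies l ε e = inj₁ e
  propagation-falsifies l (s ◅ run) e with propagation-falsifies l run e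
  ... | inj₁ σ′l = step-falsifies l s σ′l
  ... | inj₂ occ = inj₂ occ

  unit-literal-propagated : {C : Clause V} {l : Lit V} →
    Consistent F σ → UPResult _≟_ F σ τ → F C → l ∈ C →
    All (λ l′ → l′ ≡ l ⊎ litVal σ l′ ≡ just false) C → ¬ Occurs F (complement l) →
    litVal τ l ≡ just true
  unit-literal-propagated {σ = σ} {τ = τ} {l = l} consistent (run , fixpoint) C∈F l∈C unit fresh
    with litVal τ l in τl
  ... | just true = refl
  ... | nothing = ⊥-elim (fixpoint _ (_ , l , C∈F , l∈C , τl ,
          All.map (λ {l′} → Sum.map₂ (litVal-mono (propagation-extends run) l′)) unit , refl))
  ... | just false with propagation-falsifies l run τl
  ...   | inj₂ occ = ⊥-elim (fresh occ)
  ...   | inj₁ σl = ⊥-elim (consistent _ C∈F (All.map falsified unit))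
    where
    falsified : {l′ : Lit V} → l′ ≡ l ⊎ litVal σ l′ ≡ just false → litVal σ l′ ≡ just false
    falsified (inj₁ refl) = σl
    falsified (inj₂ σl′) = σl′

selClause-literal : {l : Lit (Var n m)} (is : List (Fin n)) (j : Fin m) → l ∈ selClause is j →
  (∃ λ i → l ≡ neg (x i)) ⊎ l ≡ pos (y j)
selClause-literal [] j (here refl) = inj₂ refl
selClause-literal (i ∷ is) j (here refl) = inj₁ (i , refl)
selClause-literal (i ∷ is) j (there l∈) = selClause-literal is j l∈

pos-x∉selector : {i : Fin n} → ¬ Occurs (selector n m) (pos (x i))
pos-x∉selector (_ , (j , is , _ , _ , refl) , l∈) with selClause-literal is j l∈
... | inj₁ (_ , ())
... | inj₂ ()

neg-y∉selector : {j : Fin m} → ¬ Occurs (selector n m) (neg (y j))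
neg-y∉selector (_ , (j , is , _ , _ , refl) , l∈) with selClause-literal is j l∈
... | inj₁ (_ , ())
... | inj₂ ()

neg-x∈selClause : {i : Fin n} {is : List (Fin n)} (j : Fin m) → i ∈ is → neg (x i) ∈ selClause is j
neg-x∈selClause j i∈ = ∈-++⁺ˡ (∈-map⁺ (λ i → neg (x i)) i∈)

pos-y∈selClause : (is : List (Fin n)) (j : Fin m) → pos (y j) ∈ selClause is j
pos-y∈selClause is j = ∈-++⁺ʳ (map (λ i → neg (x i)) is) (here refl)

All-selClause : {P : Lit (Var n m) → Set} {is : List (Fin n)} {j : Fin m} →
  All (λ i → P (neg (x i))) is → P (pos (y j)) → All P (selClause is j)
All-selClause Pis Pj = All.++⁺ (All.map⁺ Pis) (Pj ∷ [])

selector-clause : {is : List (Fin n)} (j : Fin m) →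
  AllPairs Fin._<_ is → length is ≡ suc (toℕ j) → selector n m (selClause is j)
selector-clause {is = is} j increasing length≡ =
  j , is , AllPairs⇒Linked increasing , length≡ , refl

elements : Subset n → List (Fin n)
elements [] = []
elements (inside ∷ p) = Fin.zero ∷ map Fin.suc (elements p)
elements (outside ∷ p) = map Fin.suc (elements p)

elements-increasing : (p : Subset n) → AllPairs Fin._<_ (elements p)
elements-increasing [] = []
elements-increasing (inside ∷ p) =
  All.map⁺ (All.universal (λ _ → z<s) (elements p)) ∷
  AllPairs.map⁺ (AllPairs.map s<s (elements-increasing p))
elements-increasing (outside ∷ p) = AllPairs.map⁺ (AllPairs.map s<s (elements-increasing p))

length-elements : (p : Subset n) → length (elements p) ≡ ∣ p ∣
length-elements [] = refl
length-elements (inside ∷ p) = cong suc (trans (length-map Fin.suc (elements p)) (length-elements p))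
length-elements (outside ∷ p) = trans (length-map Fin.suc (elements p)) (length-elements p)

elements⊆ : (p : Subset n) → All (_∈ₛ p) (elements p)
elements⊆ [] = []
elements⊆ (inside ∷ p) = here ∷ All.map⁺ (All.map there (elements⊆ p))
elements⊆ (outside ∷ p) = All.map⁺ (All.map there (elements⊆ p))

∈-elements : {i : Fin n} (p : Subset n) → i ∈ₛ p → i ∈ elements p
∈-elements (inside ∷ p) here = here refl
∈-elements (inside ∷ p) (there i∈p) = there (∈-map⁺ Fin.suc (∈-elements p i∈p))
∈-elements (outside ∷ p) (there i∈p) = ∈-map⁺ Fin.suc (∈-elements p i∈p)

x∉p⇒∣p∪⁅x⁆∣≡1+∣p∣ : (p : Subset n) (i : Fin n) → i ∉ₛ p → ∣ p ∪ ⁅ i ⁆ ∣ ≡ suc ∣ p ∣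
x∉p⇒∣p∪⁅x⁆∣≡1+∣p∣ (inside ∷ p) Fin.zero i∉p = ⊥-elim (i∉p here)
x∉p⇒∣p∪⁅x⁆∣≡1+∣p∣ (outside ∷ p) Fin.zero _ = cong (suc ∘ ∣_∣) (∪-identityʳ p)
x∉p⇒∣p∪⁅x⁆∣≡1+∣p∣ (inside ∷ p) (Fin.suc i) i∉p = cong suc (x∉p⇒∣p∪⁅x⁆∣≡1+∣p∣ p i (i∉p ∘ there))
x∉p⇒∣p∪⁅x⁆∣≡1+∣p∣ (outside ∷ p) (Fin.suc i) i∉p = x∉p⇒∣p∪⁅x⁆∣≡1+∣p∣ p i (i∉p ∘ there)

selector-clause-inside : (p : Subset n) (j : Fin m) → toℕ j < ∣ p ∣ →
  ∃ λ is → selector n m (selClause is j) × All (_∈ₛ p) is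
selector-clause-inside p j j<∣p∣ =
  is , selector-clause j (AllPairs.take⁺ _ (elements-increasing p)) length≡ , All.take⁺ _ (elements⊆ p)
  where
  is : List (Fin _)
  is = take (suc (toℕ j)) (elements p)
  length≡ : length is ≡ suc (toℕ j)
  length≡ = trans (length-take _ (elements p))
    (m≤n⇒m⊓n≡m (subst (toℕ j <_) (sym (length-elements p)) j<∣p∣))

isTrue⇒≡just-true : (b : Maybe Bool) → isTrue b ≡ true → b ≡ just true
isTrue⇒≡just-true (just true) _ = refl

trueInputs : PAssign (Var n m) → Subset n
trueInputs σ = tabulate (λ i → isTrue (σ (x i)))

∈-trueInputs⁻ : (σ : PAssign (Var n m)) {i : Fin n} → i ∈ₛ trueInputs σ → σ (x i) ≡ just true
∈-trueInputs⁻ σ {i} i∈ = isTrue⇒≡just-true (σ (x i))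
  (trans (sym (lookup∘tabulate (λ k → isTrue (σ (x k))) i)) ([]=⇒lookup i∈))

module _ {n m : ℕ} {σ τ : PAssign (Var n m)}
         (consistent : Consistent (selector n m) σ) (result : UPResult var-≟ (selector n m) σ τ) where

  open Propagation var-≟ (selector n m)

  private
    p : Subset n
    p = trueInputs σ

    falsified : {i : Fin n} → i ∈ₛ p → litVal σ (neg (x i)) ≡ just false
    falsified = litVal-neg σ ∘ ∈-trueInputs⁻ σ

  true-inputs-force-outputs : (j : Fin m) → toℕ j < numTrueInputs σ → τ (y j) ≡ just true
  true-inputs-force-outputs j j<∣p∣ with selector-clause-inside p j j<∣p∣
  ... | is , clause , is⊆p = unit-literal-propagated consistent result clause (pos-y∈selClause is j)
          (All-selClause (All.map (inj₂ ∘ falsified) is⊆p) (inj₁ refl)) neg-y∉selector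

  false-output-forces-inputs : (j : Fin m) → σ (y j) ≡ just false → numTrueInputs σ ≡ toℕ j →
    (i : Fin n) → σ (x i) ≢ just true → τ (x i) ≡ just false
  false-output-forces-inputs j yj≡0 ∣p∣≡j i xi≢1 = litVal-neg⁻ τ (unit-literal-propagated consistent result
      (selector-clause j (elements-increasing q) (trans (length-elements q) ∣q∣≡1+j))
      (neg-x∈selClause j (∈-elements q (x∈p∪q⁺ (inj₂ (x∈⁅x⁆ i)))))
      (All-selClause (All.map others (elements⊆ q)) (inj₂ yj≡0)) pos-x∉selector)
    where
    q : Subset n
    q = p ∪ ⁅ i ⁆
    ∣q∣≡1+j : ∣ q ∣ ≡ suc (toℕ j)
    ∣q∣≡1+j = trans (x∉p⇒∣p∪⁅x⁆∣≡1+∣p∣ p i (xi≢1 ∘ ∈-trueInputs⁻ σ)) (cong suc ∣p∣≡j)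
    others : {k : Fin n} → k ∈ₛ q → neg (x k) ≡ neg (x i) ⊎ litVal σ (neg (x k)) ≡ just false
    others k∈q with x∈p∪q⁻ p ⁅ i ⁆ k∈q
    ... | inj₁ k∈p = inj₂ (falsified k∈p)
    ... | inj₂ k∈⁅i⁆ = inj₁ (cong (neg ∘ x) (x∈⁅y⁆⇒x≡y i k∈⁅i⁆))

mainTheorem2 : (m n : ℕ) → m ≤ n → (σ : PAssign (Var n m)) →
    Consistent (selector n m) σ →
    ((k : ℕ) → 1 ≤ k → k ≤ n → numTrueInputs σ ≡ k →
      (τ : PAssign (Var n m)) → UPResult var-≟ (selector n m) σ τ →
      (j : Fin m) → toℕ j < k → τ (y j) ≡ just true)
    ×
    ((j : Fin m) → σ (y j) ≡ just false → numTrueInputs σ ≡ toℕ j →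
      (τ : PAssign (Var n m)) → UPResult var-≟ (selector n m) σ τ →
      (i : Fin n) → σ (x i) ≢ just true → τ (x i) ≡ just false)
mainTheorem2 m n _ σ consistent =
  (λ { k _ _ refl τ result → true-inputs-force-outputs consistent result }) ,
  (λ j yj≡0 ∣p∣≡j τ result → false-output-forces-inputs consistent result j yj≡0 ∣p∣≡j)
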